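{- Let $q\ge1$ and $a\ge0$ be coprime integers, let $u,v,h,k$ be real numbers with $h>0$, $k>0$, and let $\mathcal P$ be the parallelogram with vertices $(u,v)$, $(u,v+h)$, $(u+k,v+ak/q)$, $(u+k,v+h+ak/q)$. Then the number of straight lines of slope $a/q$ that contain at least one point of $\mathcal P\cap\mathbb Z^2$ is at most $qh+1$. -}

module Defs where

open import Level using (Level; suc; _⊔_)
open import Algebra.Bundles using (CommutativeRing)
open import Relation.Binary.Core using (Rel)
open import Relation.Binary.Structures using (IsTotalOrder)
open import Relation.Nullary using (¬_)
open import Data.Product using (_×_; _,_; proj₁; proj₂; Σ-syntax)
open import Data.Nat as ℕ using (ℕ)
open import Data.Integer as ℤ using (ℤ; +_; -[1+_])

-- An ordered field (the real numbers ℝ are one).  The theorem is stated for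
-- every ordered field; in particular it covers ℝ.
record OrderedField (c ℓ₁ ℓ₂ : Level) : Set (suc (c ⊔ ℓ₁ ⊔ ℓ₂)) where
  field
    commutativeRing : CommutativeRing c ℓ₁
  open CommutativeRing commutativeRing public
  field
    _≤_           : Rel Carrier ℓ₂
    isTotalOrder  : IsTotalOrder _≈_ _≤_
    0≉1           : ¬ (0# ≈ 1#)
    inverse       : ∀ x → ¬ (x ≈ 0#) → Σ[ y ∈ Carrier ] (x * y ≈ 1#)
    +-monoʳ-≤     : ∀ z {x y} → x ≤ y → (z + x) ≤ (z + y)
    *-nonneg      : ∀ {x y} → 0# ≤ x → 0# ≤ y → 0# ≤ (x * y)

  infix 4 _<_ _≤_
  _<_ : Rel Carrier _
  x < y = (x ≤ y) × ¬ (x ≈ y)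

  fromℕ : ℕ → Carrier
  fromℕ ℕ.zero    = 0#
  fromℕ (ℕ.suc n) = 1# + fromℕ n

  fromℤ : ℤ → Carrier
  fromℤ (+ n)    = fromℕ n
  fromℤ -[1+ n ] = - fromℕ (ℕ.suc n)

module _ {c ℓ₁ ℓ₂} (F : OrderedField c ℓ₁ ℓ₂) where
  open OrderedField F

  -- The parallelogram with vertices (u,v), (u,v+h), (u+k,v+sk), (u+k,v+h+sk)
  -- where s is the slope (s = a/q):  points (x,y) with u ≤ x ≤ u+k and
  -- v + s(x-u) ≤ y ≤ v + h + s(x-u).
  InParallelogram : (s u v h k : Carrier) → Carrier → Carrier → Set ℓ₂
  InParallelogram s u v h k x y =
    (u ≤ x) × (x ≤ u + k) ×
    (v + s * (x - u) ≤ y) × (y ≤ v + h + s * (x - u))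

  intercept : (s : Carrier) → ℤ × ℤ → Carrier
  intercept s (x , y) = fromℤ y - s * fromℤ x

module Submission where

-- The line of slope s = a/q through a lattice point (x , y) has intercept
-- y - s x, and q times this intercept is the integer q y - a x.  For a point
-- of the parallelogram P the intercept lies in [c , c + h], where
-- c = v - s u, because P is bounded by the two lines of slope s with
-- intercepts c and c + h.  Hence the lines through the lattice points of P
-- are indexed by distinct integers in an interval of length q h, and there
-- are at most q h + 1 of them.  The argument works in any ordered field.

open import Defs
open import Data.Nat using (ℕ; _≥_)
open import Data.Nat.Coprimality using (Coprime)
open import Data.Integer using (ℤ)
open import Data.Product using (_×_; _,_; proj₁; proj₂)
open import Data.List using (List; length)
open import Data.List.Relation.Unary.All using (All)
open import Data.List.Relation.Unary.AllPairs using (AllPairs)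
open import Relation.Nullary using (¬_)

open import Data.Nat as ℕ using (suc; zero; z≤n; s≤s)
import Data.Nat.Properties as ℕP
open import Data.Integer as ℤ using (+_; -[1+_]; _⊖_; ∣_∣)
import Data.Integer.Properties as ℤP
open import Algebra.Properties.Ring ℤP.+-*-ring using () renaming (+-cancelʳ to ℤ-+-cancelʳ)
open import Data.List using ([]; _∷_; map; lookup)
open import Data.List.Properties using (length-map)
open import Data.List.Relation.Unary.All as All using (_∷_)
import Data.List.Relation.Unary.All.Properties as All
open import Data.List.Relation.Unary.AllPairs as AllPairs using (_∷_)
import Data.List.Relation.Unary.AllPairs.Properties as AllPairs
open import Data.List.Relation.Unary.Unique.Propositional using (Unique)
open import Data.List.Membership.Propositional.Properties using (∈-lookup)
import Data.List.Extrema ℤP.≤-totalOrder as ℤExtrema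
open import Data.Fin using (Fin; zero; suc; fromℕ<; toℕ)
open import Data.Fin.Properties using (injective⇒≤; toℕ-fromℕ<)
open import Data.Sum using (inj₁; inj₂)
open import Function.Base using (id)
open import Function.Definitions using (Injective)
open import Relation.Nullary using (contradiction)
open import Relation.Binary.Bundles using (Poset)
open import Relation.Binary.Structures using (IsTotalOrder)
open import Relation.Binary.PropositionalEquality as ≡ using (_≡_; _≢_; cong)

lookup-injective : ∀ {a} {A : Set a} {xs : List A} → Unique xs →
                   Injective _≡_ _≡_ (lookup xs)
lookup-injective (_ ∷ _) {zero} {zero} _ = ≡.refl
lookup-injective (x∉xs ∷ _) {zero} {suc j} eq =
  contradiction eq (All.lookup x∉xs (∈-lookup j))
lookup-injective (x∉xs ∷ _) {suc i} {zero} eq =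
  contradiction (≡.sym eq) (All.lookup x∉xs (∈-lookup i))
lookup-injective (_ ∷ distinct) {suc i} {suc j} eq =
  cong suc (lookup-injective distinct eq)

+∣n-lo∣≡n-lo : ∀ {lo n} → lo ℤ.≤ n → + ∣ n ℤ.- lo ∣ ≡ n ℤ.- lo
+∣n-lo∣≡n-lo lo≤n = ℤP.0≤i⇒+∣i∣≡i (ℤP.i≤j⇒0≤j-i lo≤n)

-- Pigeonhole principle in ℤ: a repetition-free list of integers in
-- [lo , hi] has at most hi - lo + 1 entries.  The distance from lo is an
-- injection of its positions into Fin (hi - lo + 1).
unique-in-interval : ∀ {lo hi} {ns : List ℤ} → Unique ns →
  All (λ n → lo ℤ.≤ n × n ℤ.≤ hi) ns → length ns ℕ.≤ suc ∣ hi ℤ.- lo ∣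
unique-in-interval {lo} {hi} {ns} distinct bounds = injective⇒≤ offset-injective
  where
  bound : ∀ i → lo ℤ.≤ lookup ns i × lookup ns i ℤ.≤ hi
  bound i = All.lookup bounds (∈-lookup i)

  offset-< : ∀ i → ∣ lookup ns i ℤ.- lo ∣ ℕ.< suc ∣ hi ℤ.- lo ∣
  offset-< i with lo≤n , n≤hi ← bound i = s≤s (ℤP.drop‿+≤+ (begin
    + ∣ lookup ns i ℤ.- lo ∣  ≡⟨ +∣n-lo∣≡n-lo lo≤n ⟩
    lookup ns i ℤ.- lo       ≤⟨ ℤP.+-monoˡ-≤ (ℤ.- lo) n≤hi ⟩
    hi ℤ.- lo                ≡⟨ +∣n-lo∣≡n-lo (ℤP.≤-trans lo≤n n≤hi) ⟨
    + ∣ hi ℤ.- lo ∣          ∎))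
    where open ℤP.≤-Reasoning

  offset : Fin (length ns) → Fin (suc ∣ hi ℤ.- lo ∣)
  offset i = fromℕ< (offset-< i)

  offset-injective : Injective _≡_ _≡_ offset
  offset-injective {i} {j} eq = lookup-injective distinct
    (ℤ-+-cancelʳ (ℤ.- lo) (lookup ns i) (lookup ns j) (begin
      lookup ns i ℤ.- lo       ≡⟨ +∣n-lo∣≡n-lo (proj₁ (bound i)) ⟨
      + ∣ lookup ns i ℤ.- lo ∣ ≡⟨ cong +_ same-offset ⟩
      + ∣ lookup ns j ℤ.- lo ∣ ≡⟨ +∣n-lo∣≡n-lo (proj₁ (bound j)) ⟩
      lookup ns j ℤ.- lo       ∎))
    where
    open ≡.≡-Reasoning
    same-offset : ∣ lookup ns i ℤ.- lo ∣ ≡ ∣ lookup ns j ℤ.- lo ∣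
    same-offset = begin
      ∣ lookup ns i ℤ.- lo ∣   ≡⟨ toℕ-fromℕ< (offset-< i) ⟨
      toℕ (offset i)          ≡⟨ cong toℕ eq ⟩
      toℕ (offset j)          ≡⟨ toℕ-fromℕ< (offset-< j) ⟩
      ∣ lookup ns j ℤ.- lo ∣   ∎

unique-spread : (n : ℤ) (ns : List ℤ) → Unique (n ∷ ns) →
  length (n ∷ ns) ℕ.≤ suc ∣ ℤExtrema.max n ns ℤ.- ℤExtrema.min n ns ∣
unique-spread n ns distinct = unique-in-interval distinct (All.zip
  ( (ℤExtrema.min≤⊤ n ns ∷ ℤExtrema.min≤xs n ns)
  , (ℤExtrema.⊥≤max n ns ∷ ℤExtrema.xs≤max n ns)))

-- q times the intercept of the line of slope a/q through (x , y).
scaledIntercept : ℕ → ℕ → ℤ × ℤ → ℤ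
scaledIntercept q a (x , y) = + q ℤ.* y ℤ.- + a ℤ.* x

module OrderedFieldProperties {c ℓ₁ ℓ₂} (F : OrderedField c ℓ₁ ℓ₂) where
  open OrderedField F
  open IsTotalOrder isTotalOrder using (total; antisym)
  open import Algebra.Properties.Ring ring
    using (-0#≈0#; -‿involutive; -‿+-comm; -1*x≈-x; x[y-z]≈xy-xz;
           xyx⁻¹≈y; \\-leftDividesˡ; //-rightDividesʳ)

  poset : Poset c ℓ₁ ℓ₂
  poset = record { isPartialOrder = IsTotalOrder.isPartialOrder isTotalOrder }

  open import Relation.Binary.Reasoning.PartialOrder poset

  [x+y]-[x+z]≈y-z : ∀ x y z → (x + y) - (x + z) ≈ y - z
  [x+y]-[x+z]≈y-z x y z = begin-equality
    (x + y) - (x + z)       ≈⟨ +-congˡ (-‿+-comm x z) ⟨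
    (x + y) + (- x + - z)   ≈⟨ +-congʳ (+-comm x y) ⟩
    (y + x) + (- x + - z)   ≈⟨ +-assoc y x (- x + - z) ⟩
    y + (x + (- x + - z))   ≈⟨ +-congˡ (\\-leftDividesˡ x (- z)) ⟩
    y - z                   ∎

  [w+[x-y]]-x≈w-y : ∀ w x y → (w + (x - y)) - x ≈ w - y
  [w+[x-y]]-x≈w-y w x y = begin-equality
    (w + (x - y)) - x       ≈⟨ +-congʳ (+-congˡ (+-comm x (- y))) ⟩
    (w + (- y + x)) - x     ≈⟨ +-congʳ (+-assoc w (- y) x) ⟨
    ((w - y) + x) - x       ≈⟨ //-rightDividesʳ x (w - y) ⟩
    w - y                   ∎

  +-monoˡ-≤ : ∀ z {x y} → x ≤ y → x + z ≤ y + z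
  +-monoˡ-≤ z {x} {y} x≤y = begin
    x + z   ≈⟨ +-comm x z ⟩
    z + x   ≤⟨ +-monoʳ-≤ z x≤y ⟩
    z + y   ≈⟨ +-comm z y ⟩
    y + z   ∎

  +-mono-≤ : ∀ {x y z w} → x ≤ y → z ≤ w → x + z ≤ y + w
  +-mono-≤ {x} {y} {z} {w} x≤y z≤w = begin
    x + z   ≤⟨ +-monoˡ-≤ z x≤y ⟩
    y + z   ≤⟨ +-monoʳ-≤ y z≤w ⟩
    y + w   ∎

  neg-antimono-≤ : ∀ {x y} → x ≤ y → - y ≤ - x
  neg-antimono-≤ {x} {y} x≤y = begin
    - y               ≈⟨ \\-leftDividesˡ x (- y) ⟨
    x + (- x + - y)   ≤⟨ +-monoˡ-≤ (- x + - y) x≤y ⟩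
    y + (- x + - y)   ≈⟨ +-congˡ (+-comm (- x) (- y)) ⟩
    y + (- y + - x)   ≈⟨ \\-leftDividesˡ y (- x) ⟩
    - x               ∎

  difference-bound : ∀ {a b L H} → a ≤ L + H → L ≤ b → a - b ≤ H
  difference-bound {a} {b} {L} {H} a≤L+H L≤b = begin
    a - b         ≤⟨ +-mono-≤ a≤L+H (neg-antimono-≤ L≤b) ⟩
    (L + H) - L   ≈⟨ xyx⁻¹≈y L H ⟩
    H             ∎

  *-monoˡ-≤ : ∀ {w x y} → 0# ≤ w → x ≤ y → w * x ≤ w * y
  *-monoˡ-≤ {w} {x} {y} 0≤w x≤y = begin
    w * x                   ≈⟨ +-identityʳ (w * x) ⟨
    w * x + 0#              ≤⟨ +-monoʳ-≤ (w * x) (*-nonneg 0≤w 0≤y-x) ⟩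
    w * x + w * (y - x)     ≈⟨ +-congˡ (x[y-z]≈xy-xz w y x) ⟩
    w * x + (w * y - w * x) ≈⟨ +-congˡ (+-comm (w * y) (- (w * x))) ⟩
    w * x + (- (w * x) + w * y) ≈⟨ \\-leftDividesˡ (w * x) (w * y) ⟩
    w * y                   ∎
    where
    0≤y-x : 0# ≤ y - x
    0≤y-x = begin
      0#      ≈⟨ -‿inverseʳ x ⟨
      x - x   ≤⟨ +-monoˡ-≤ (- x) x≤y ⟩
      y - x   ∎

  -- In an ordered field 1 is non-negative: otherwise -1 ≥ 0 and 1 = (-1)(-1).
  0≤1 : 0# ≤ 1#
  0≤1 with total 0# 1#
  ... | inj₁ 0≤1 = 0≤1
  ... | inj₂ 1≤0 = begin
    0#            ≤⟨ *-nonneg 0≤-1 0≤-1 ⟩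
    - 1# * - 1#   ≈⟨ -1*x≈-x (- 1#) ⟩
    - - 1#        ≈⟨ -‿involutive 1# ⟩
    1#            ∎
    where
    0≤-1 : 0# ≤ - 1#
    0≤-1 = begin
      0#     ≈⟨ -0#≈0# ⟨
      - 0#   ≤⟨ neg-antimono-≤ 1≤0 ⟩
      - 1#   ∎

  fromℕ-mono : ∀ {m n} → m ℕ.≤ n → fromℕ m ≤ fromℕ n
  fromℕ-mono {n = zero}  z≤n = begin 0# ∎
  fromℕ-mono {n = suc n} z≤n = begin
    0#              ≈⟨ +-identityʳ 0# ⟨
    0# + 0#         ≤⟨ +-mono-≤ 0≤1 (fromℕ-mono {n = n} z≤n) ⟩
    1# + fromℕ n    ∎
  fromℕ-mono (s≤s m≤n) = +-monoʳ-≤ 1# (fromℕ-mono m≤n)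

  fromℕ-nonneg : ∀ n → 0# ≤ fromℕ n
  fromℕ-nonneg n = fromℕ-mono {0} {n} z≤n

  fromℕ-≉0 : ∀ {n} → n ≥ 1 → ¬ (fromℕ n ≈ 0#)
  fromℕ-≉0 {n} n≥1 n≈0 = 0≉1 (antisym 0≤1 1≤0)
    where
    1≤0 : 1# ≤ 0#
    1≤0 = begin
      1#            ≈⟨ +-identityʳ 1# ⟨
      1# + 0#       ≤⟨ fromℕ-mono n≥1 ⟩
      fromℕ n       ≈⟨ n≈0 ⟩
      0#            ∎

  *-cancelˡ : ∀ {z x y} → ¬ (z ≈ 0#) → z * x ≈ z * y → x ≈ y
  *-cancelˡ {z} {x} {y} z≉0 zx≈zy = begin-equality
    x                 ≈⟨ z⁻¹[zw]≈w x ⟨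
    z⁻¹ * (z * x)     ≈⟨ *-congˡ zx≈zy ⟩
    z⁻¹ * (z * y)     ≈⟨ z⁻¹[zw]≈w y ⟩
    y                 ∎
    where
    z⁻¹ = proj₁ (inverse z z≉0)
    z⁻¹[zw]≈w : ∀ w → z⁻¹ * (z * w) ≈ w
    z⁻¹[zw]≈w w = begin-equality
      z⁻¹ * (z * w)   ≈⟨ *-assoc z⁻¹ z w ⟨
      (z⁻¹ * z) * w   ≈⟨ *-congʳ (*-comm z⁻¹ z) ⟩
      (z * z⁻¹) * w   ≈⟨ *-congʳ (proj₂ (inverse z z≉0)) ⟩
      1# * w          ≈⟨ *-identityˡ w ⟩
      w               ∎

  fromℕ-+ : ∀ m n → fromℕ (m ℕ.+ n) ≈ fromℕ m + fromℕ n
  fromℕ-+ zero    n = sym (+-identityˡ (fromℕ n))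
  fromℕ-+ (suc m) n = trans (+-congˡ (fromℕ-+ m n)) (sym (+-assoc 1# (fromℕ m) (fromℕ n)))

  fromℤ-neg : ∀ i → fromℤ (ℤ.- i) ≈ - fromℤ i
  fromℤ-neg (+ zero)  = sym -0#≈0#
  fromℤ-neg (+ suc n) = refl
  fromℤ-neg -[1+ n ]  = sym (-‿involutive (fromℕ (suc n)))

  fromℤ-⊖ : ∀ m n → fromℤ (m ⊖ n) ≈ fromℕ m - fromℕ n
  fromℤ-⊖ m       zero    = sym (trans (+-congˡ -0#≈0#) (+-identityʳ (fromℕ m)))
  fromℤ-⊖ zero    (suc n) = sym (+-identityˡ (- fromℕ (suc n)))
  fromℤ-⊖ (suc m) (suc n) = begin-equality
    fromℤ (suc m ⊖ suc n)             ≡⟨ cong fromℤ (ℤP.[1+m]⊖[1+n]≡m⊖n m n) ⟩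
    fromℤ (m ⊖ n)                     ≈⟨ fromℤ-⊖ m n ⟩
    fromℕ m - fromℕ n                 ≈⟨ [x+y]-[x+z]≈y-z 1# (fromℕ m) (fromℕ n) ⟨
    fromℕ (suc m) - fromℕ (suc n)     ∎

  fromℤ-+ : ∀ i j → fromℤ (i ℤ.+ j) ≈ fromℤ i + fromℤ j
  fromℤ-+ (+ m)    (+ n)    = fromℕ-+ m n
  fromℤ-+ (+ m)    -[1+ n ] = fromℤ-⊖ m (suc n)
  fromℤ-+ -[1+ m ] (+ n)    = trans (fromℤ-⊖ n (suc m)) (+-comm (fromℕ n) _)
  fromℤ-+ -[1+ m ] -[1+ n ] = begin-equality
    - fromℕ (suc (suc (m ℕ.+ n)))          ≡⟨ cong (λ t → - fromℕ (suc t)) (ℕP.+-suc m n) ⟨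
    - fromℕ (suc m ℕ.+ suc n)              ≈⟨ -‿cong (fromℕ-+ (suc m) (suc n)) ⟩
    - (fromℕ (suc m) + fromℕ (suc n))      ≈⟨ -‿+-comm (fromℕ (suc m)) (fromℕ (suc n)) ⟨
    - fromℕ (suc m) + - fromℕ (suc n)      ∎

  fromℤ-- : ∀ i j → fromℤ (i ℤ.- j) ≈ fromℤ i - fromℤ j
  fromℤ-- i j = trans (fromℤ-+ i (ℤ.- j)) (+-congˡ (fromℤ-neg j))

  fromℤ-scale : ∀ n j → fromℤ (+ n ℤ.* j) ≈ fromℕ n * fromℤ j
  fromℤ-scale zero    j = sym (zeroˡ (fromℤ j))
  fromℤ-scale (suc n) j = begin-equality
    fromℤ (+ suc n ℤ.* j)                 ≡⟨ cong fromℤ (ℤP.suc-* (+ n) j) ⟩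
    fromℤ (j ℤ.+ + n ℤ.* j)               ≈⟨ fromℤ-+ j (+ n ℤ.* j) ⟩
    fromℤ j + fromℤ (+ n ℤ.* j)           ≈⟨ +-cong (sym (*-identityˡ (fromℤ j))) (fromℤ-scale n j) ⟩
    1# * fromℤ j + fromℕ n * fromℤ j      ≈⟨ distribʳ (fromℤ j) 1# (fromℕ n) ⟨
    fromℕ (suc n) * fromℤ j               ∎

  -- Pigeonhole principle in an ordered field: distinct integers whose images
  -- lie in an interval [L , L + H] with H ≥ 0 number at most H + 1.  The
  -- images of the least and greatest of them are H apart at most.
  unique-in-field-interval : ∀ {L H} (ns : List ℤ) → 0# ≤ H → Unique ns →
    All (λ n → L ≤ fromℤ n × fromℤ n ≤ L + H) ns → fromℕ (length ns) ≤ H + 1#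
  unique-in-field-interval {H = H} [] 0≤H _ _ = begin
    0#        ≈⟨ +-identityʳ 0# ⟨
    0# + 0#   ≤⟨ +-mono-≤ 0≤H 0≤1 ⟩
    H + 1#    ∎
  unique-in-field-interval {L} {H} (n ∷ ns) _ distinct bounds = begin
    fromℕ (length (n ∷ ns))     ≤⟨ fromℕ-mono (unique-spread n ns distinct) ⟩
    1# + fromℤ (+ ∣ M ℤ.- m ∣)   ≡⟨ cong (λ i → 1# + fromℤ i) (+∣n-lo∣≡n-lo m≤M) ⟩
    1# + fromℤ (M ℤ.- m)        ≈⟨ +-congˡ (fromℤ-- M m) ⟩
    1# + (fromℤ M - fromℤ m)    ≤⟨ +-monoʳ-≤ 1# (difference-bound M≤L+H L≤m) ⟩
    1# + H                      ≈⟨ +-comm 1# H ⟩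
    H + 1#                      ∎
    where
    m = ℤExtrema.min n ns
    M = ℤExtrema.max n ns
    m≤M : m ℤ.≤ M
    m≤M = ℤP.≤-trans (ℤExtrema.min≤⊤ n ns) (ℤExtrema.⊥≤max n ns)
    L≤m : L ≤ fromℤ m
    L≤m with b ∷ bs ← All.map proj₁ bounds =
      ℤExtrema.argmin-all id {P = λ i → L ≤ fromℤ i} b bs
    M≤L+H : fromℤ M ≤ L + H
    M≤L+H with b ∷ bs ← All.map proj₂ bounds =
      ℤExtrema.argmax-all id {P = λ i → fromℤ i ≤ L + H} b bs

  intercept-bounds : ∀ {s u v h k X Y} → InParallelogram F s u v h k X Y →
    v - s * u ≤ Y - s * X × Y - s * X ≤ (v - s * u) + h
  intercept-bounds {s} {u} {v} {h} {X = X} {Y} (_ , _ , lower , upper) =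
    (begin
      v - s * u                       ≈⟨ shift v ⟨
      (v + s * (X - u)) - s * X       ≤⟨ +-monoˡ-≤ (- (s * X)) lower ⟩
      Y - s * X                       ∎) ,
    (begin
      Y - s * X                       ≤⟨ +-monoˡ-≤ (- (s * X)) upper ⟩
      (v + h + s * (X - u)) - s * X   ≈⟨ shift (v + h) ⟩
      (v + h) - s * u                 ≈⟨ +-assoc v h (- (s * u)) ⟩
      v + (h - s * u)                 ≈⟨ +-congˡ (+-comm h (- (s * u))) ⟩
      v + (- (s * u) + h)             ≈⟨ +-assoc v (- (s * u)) h ⟨
      (v - s * u) + h                 ∎)
    where
    shift : ∀ w → (w + s * (X - u)) - s * X ≈ w - s * u
    shift w = trans (+-congʳ (+-congˡ (x[y-z]≈xy-xz s X u)))
                    ([w+[x-y]]-x≈w-y w (s * X) (s * u))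

  scaledIntercept-≈ : ∀ q a {s} → fromℕ q * s ≈ fromℕ a → ∀ p →
    fromℤ (scaledIntercept q a p) ≈ fromℕ q * intercept F s p
  scaledIntercept-≈ q a {s} qs≈a (x , y) = begin-equality
    fromℤ (+ q ℤ.* y ℤ.- + a ℤ.* x)          ≈⟨ fromℤ-- (+ q ℤ.* y) (+ a ℤ.* x) ⟩
    fromℤ (+ q ℤ.* y) - fromℤ (+ a ℤ.* x)    ≈⟨ +-cong (fromℤ-scale q y) (-‿cong (fromℤ-scale a x)) ⟩
    Q * Y - fromℕ a * X                      ≈⟨ +-congˡ (-‿cong (*-congʳ qs≈a)) ⟨
    Q * Y - (Q * s) * X                      ≈⟨ +-congˡ (-‿cong (*-assoc Q s X)) ⟩
    Q * Y - Q * (s * X)                      ≈⟨ x[y-z]≈xy-xz Q Y (s * X) ⟨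
    Q * (Y - s * X)                          ∎
    where
    Q = fromℕ q
    X = fromℤ x
    Y = fromℤ y

  scaledIntercept-bounds : ∀ q a {s u v h k} → fromℕ q * s ≈ fromℕ a → ∀ p →
    InParallelogram F s u v h k (fromℤ (proj₁ p)) (fromℤ (proj₂ p)) →
    fromℕ q * (v - s * u) ≤ fromℤ (scaledIntercept q a p) ×
    fromℤ (scaledIntercept q a p) ≤ fromℕ q * (v - s * u) + fromℕ q * h
  scaledIntercept-bounds q a {s} {u} {v} {h} qs≈a p inside
    with lower , upper ← intercept-bounds inside =
    (begin
      Q * (v - s * u)                 ≤⟨ *-monoˡ-≤ (fromℕ-nonneg q) lower ⟩
      Q * intercept F s p             ≈⟨ scaledIntercept-≈ q a qs≈a p ⟨
      fromℤ (scaledIntercept q a p)   ∎) ,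
    (begin
      fromℤ (scaledIntercept q a p)   ≈⟨ scaledIntercept-≈ q a qs≈a p ⟩
      Q * intercept F s p             ≤⟨ *-monoˡ-≤ (fromℕ-nonneg q) upper ⟩
      Q * ((v - s * u) + h)           ≈⟨ distribˡ Q (v - s * u) h ⟩
      Q * (v - s * u) + Q * h         ∎)
    where
    Q = fromℕ q

  scaledIntercept-unique : ∀ q a {s} → q ≥ 1 → fromℕ q * s ≈ fromℕ a →
    ∀ {pts} → AllPairs (λ p p′ → ¬ (intercept F s p ≈ intercept F s p′)) pts →
    Unique (map (scaledIntercept q a) pts)
  scaledIntercept-unique q a {s} q≥1 qs≈a distinct =
    AllPairs.map⁺ (AllPairs.map separate distinct)
    where
    separate : ∀ {p p′} → ¬ (intercept F s p ≈ intercept F s p′) →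
               scaledIntercept q a p ≢ scaledIntercept q a p′
    separate {p} {p′} p≉p′ eq = p≉p′ (*-cancelˡ (fromℕ-≉0 q≥1) (begin-equality
      fromℕ q * intercept F s p      ≈⟨ scaledIntercept-≈ q a qs≈a p ⟨
      fromℤ (scaledIntercept q a p)  ≡⟨ cong fromℤ eq ⟩
      fromℤ (scaledIntercept q a p′) ≈⟨ scaledIntercept-≈ q a qs≈a p′ ⟩
      fromℕ q * intercept F s p′     ∎))

mainTheorem6 : ∀ {c ℓ₁ ℓ₂} (F : OrderedField c ℓ₁ ℓ₂) →
    let open OrderedField F in
    (q a : ℕ) → q ≥ 1 → Coprime q a →
    (s : Carrier) → fromℕ q * s ≈ fromℕ a →
    (u v h k : Carrier) → 0# < h → 0# < k →
    (pts : List (ℤ × ℤ)) →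
    All (λ p → InParallelogram F s u v h k (fromℤ (proj₁ p)) (fromℤ (proj₂ p))) pts →
    AllPairs (λ p p′ → ¬ (intercept F s p ≈ intercept F s p′)) pts →
    fromℕ (length pts) ≤ fromℕ q * h + 1#
mainTheorem6 F q a q≥1 _ s qs≈a _ _ h _ (0≤h , _) _ pts inside distinct = begin
  fromℕ (length pts)                      ≡⟨ cong fromℕ (length-map (scaledIntercept q a) pts) ⟨
  fromℕ (length (map (scaledIntercept q a) pts))
    ≤⟨ unique-in-field-interval (map (scaledIntercept q a) pts)
         (*-nonneg (fromℕ-nonneg q) 0≤h)
         (scaledIntercept-unique q a q≥1 qs≈a distinct)
         (All.map⁺ (All.map (λ {p} → scaledIntercept-bounds q a qs≈a p) inside)) ⟩
  fromℕ q * h + 1#                        ∎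
  where
  open OrderedField F
  open OrderedFieldProperties F
  open import Relation.Binary.Reasoning.PartialOrder poset
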